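{- Let $D$ be a display sequent. Then (1) $\mathfrak L_w(D)$ is a labeled polytree sequent; (2) $|\mathfrak L_w(D)|\le|D|$; (3) for all labels $w,u$, $\mathfrak L_w(D)\cong\mathfrak L_u(D)$.
   Context: Formulae: $A ::= p \mid \top \mid \bot \mid \neg A \mid (A\lor A)\mid (A\land A)\mid (A\to A)\mid \mathsf{G}A\mid \mathsf{F}A\mid \mathsf{H}A\mid \mathsf{P}A$. Structures: $X ::= A \mid I \mid {\ast}X \mid {\bullet}X \mid (X\circ X)$; a display sequent is $X\vdash Y$. Lengths: $|A|=|I|=1$, $|{\ast}X|=|{\bullet}X|=|X|+1$, $|X\circ Y|=|X|+|Y|+1$, $|X\vdash Y|=|X|+|Y|$. A labeled sequent is $\mathcal R,\Gamma\Rightarrow\Delta$ with $\mathcal R$ a finite set of relational atoms $Rwu$ and $\Gamma,\Delta$ finite multisets of labeled formulae $w:A$ ($w,u$ labels); its length is $|\mathcal R|+|\Gamma|+|\Delta|$. Composition: $(\mathcal R_1,\Gamma_1\Rightarrow\Delta_1)\otimes(\mathcal R_2,\Gamma_2\Rightarrow\Delta_2)=(\mathcal R_1\cup\mathcal R_2,\Gamma_1\uplus\Gamma_2\Rightarrow\Delta_1\uplus\Delta_2)$. Two labeled sequents are isomorphic ($\cong$) if a bijection $f$ of their label sets satisfies $Rwu\in\mathcal R_1\iff Rf(w)f(u)\in\mathcal R_2$, $w:A\in\Gamma_1\iff f(w):A\in\Gamma_2$, $w:A\in\Delta_1\iff f(w):A\in\Delta_2$. A labeled polytree sequent is one that (1)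 if it has no relational atoms has all labeled formulae with one common label, (2) otherwise has every formula label occurring in a relational atom, and (3) has graph (nodes labels, edges $(w,u)$ for $Rwu$) connected and free of directed and undirected cycles. Translation: $\mathfrak L_w(X\vdash Y)=\mathfrak L^w_1(X)\otimes\mathfrak L^w_2(Y)$, where $\mathfrak L^w_1(I)=\mathfrak L^w_2(I)=(\emptyset\Rightarrow\emptyset)$; $\mathfrak L^w_1(A)=(w:A\Rightarrow\emptyset)$, $\mathfrak L^w_2(A)=(\emptyset\Rightarrow w:A)$; $\mathfrak L^w_1({\ast}X)=\mathfrak L^w_2(X)$, $\mathfrak L^w_2({\ast}X)=\mathfrak L^w_1(X)$; $\mathfrak L^w_1({\bullet}X)=(Ruw\Rightarrow\emptyset)\otimes\mathfrak L^u_1(X)$, $\mathfrak L^w_2({\bullet}X)=(Rwv\Rightarrow\emptyset)\otimes\mathfrak L^v_2(X)$ with $u$, $v$ fresh labels; $\mathfrak L^w_i(X\circ Y)=\mathfrak L^w_i(X)\otimes\mathfrak L^w_i(Y)$. -}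

module Defs where

open import Data.Nat using (ℕ; suc; _+_; _≤_)
open import Data.Nat.Properties using (_≟_)
open import Data.Product using (_×_; _,_; Σ; ∃; ∃-syntax; proj₁)
open import Data.Product.Properties using (≡-dec)
open import Data.List using (List; []; _∷_; _++_; length; deduplicate; map)
open import Data.List.Membership.Propositional using (_∈_)
open import Data.List.Relation.Unary.Unique.Propositional using (Unique)
open import Relation.Binary.PropositionalEquality using (_≡_; _≢_)
open import Relation.Nullary using (¬_)
open import Data.Sum using (_⊎_)

data Fm : Set where
  var  : ℕ → Fm
  ⊤'   : Fm
  ⊥'   : Fm
  ¬'   : Fm → Fm
  _∨'_ : Fm → Fm → Fm
  _∧'_ : Fm → Fm → Fm
  _⇒'_ : Fm → Fm → Fm
  G F H P : Fm → Fm

data Str : Set where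
  fm  : Fm → Str
  I   : Str
  ast : Str → Str
  bul : Str → Str
  _∘_ : Str → Str → Str

record DSeq : Set where
  constructor _⊢_
  field
    lhs rhs : Str

strLen : Str → ℕ
strLen (fm A)  = 1
strLen I       = 1
strLen (ast X) = strLen X + 1
strLen (bul X) = strLen X + 1
strLen (X ∘ Y) = strLen X + strLen Y + 1

dLen : DSeq → ℕ
dLen (X ⊢ Y) = strLen X + strLen Y

-- The relational part is a list read as a finite SET (membership only;
-- its size is the number of distinct atoms); Γ, Δ are lists read as
-- multisets.

Label : Set
Label = ℕ

RelAtom : Set
RelAtom = Label × Label     -- (w , u) stands for R w u

LFm : Set
LFm = Label × Fm           -- (w , A) stands for w : A

record LSeq : Set where
  constructor lseq
  field
    rel : List RelAtom
    ant : List LFm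
    suc' : List LFm
open LSeq public

emptyL : LSeq
emptyL = lseq [] [] []

_⊗_ : LSeq → LSeq → LSeq
lseq R₁ Γ₁ Δ₁ ⊗ lseq R₂ Γ₂ Δ₂ = lseq (R₁ ++ R₂) (Γ₁ ++ Γ₂) (Δ₁ ++ Δ₂)

lLen : LSeq → ℕ
lLen (lseq R Γ Δ) = length (deduplicate (≡-dec _≟_ _≟_) R) + length Γ + length Δ

labelsR : List RelAtom → List Label
labelsR []            = []
labelsR ((w , u) ∷ R) = w ∷ u ∷ labelsR R

labels : LSeq → List Label
labels (lseq R Γ Δ) = labelsR R ++ map proj₁ Γ ++ map proj₁ Δ

record _≅_ (S₁ S₂ : LSeq) : Set where
  field
    f      : Label → Label
    into   : ∀ {w} → w ∈ labels S₁ → f w ∈ labels S₂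
    inj    : ∀ {w u} → w ∈ labels S₁ → u ∈ labels S₁ → f w ≡ f u → w ≡ u
    onto   : ∀ {v} → v ∈ labels S₂ → ∃[ w ] (w ∈ labels S₁ × f w ≡ v)
    relIso : ∀ {w u} → w ∈ labels S₁ → u ∈ labels S₁ →
             ((w , u) ∈ rel S₁ → (f w , f u) ∈ rel S₂) ×
             ((f w , f u) ∈ rel S₂ → (w , u) ∈ rel S₁)
    antIso : ∀ {w} A → w ∈ labels S₁ →
             ((w , A) ∈ ant S₁ → (f w , A) ∈ ant S₂) ×
             ((f w , A) ∈ ant S₂ → (w , A) ∈ ant S₁)
    sucIso : ∀ {w} A → w ∈ labels S₁ →
             ((w , A) ∈ suc' S₁ → (f w , A) ∈ suc' S₂) ×
             ((f w , A) ∈ suc' S₂ → (w , A) ∈ suc' S₁)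

data UTrail (R : List RelAtom) : Label → Label → List RelAtom → Set where
  here : ∀ {v} → UTrail R v v []
  fwd  : ∀ {u v x es} → (u , v) ∈ R → UTrail R v x es → UTrail R u x ((u , v) ∷ es)
  bwd  : ∀ {u v x es} → (v , u) ∈ R → UTrail R v x es → UTrail R u x ((v , u) ∷ es)

data DTrail (R : List RelAtom) : Label → Label → List RelAtom → Set where
  here : ∀ {v} → DTrail R v v []
  fwd  : ∀ {u v x es} → (u , v) ∈ R → DTrail R v x es → DTrail R u x ((u , v) ∷ es)

HasUndirectedCycle : List RelAtom → Set
HasUndirectedCycle R = ∃[ v ] ∃[ es ] (UTrail R v v es × es ≢ [] × Unique es)

HasDirectedCycle : List RelAtom → Set
HasDirectedCycle R = ∃[ v ] ∃[ es ] (DTrail R v v es × es ≢ [] × Unique es)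

Connected : LSeq → Set
Connected S = ∀ {v x} → v ∈ labels S → x ∈ labels S → ∃[ es ] UTrail (rel S) v x es

IsPolytree : LSeq → Set
IsPolytree S =
  (rel S ≡ [] → ∃[ v ] (∀ {w A} → (w , A) ∈ (ant S ++ suc' S) → w ≡ v))
  × (rel S ≢ [] → ∀ {w A} → (w , A) ∈ (ant S ++ suc' S) →
       ∃[ u ] ((w , u) ∈ rel S ⊎ (u , w) ∈ rel S))
  × Connected S
  × ¬ HasDirectedCycle (rel S)
  × ¬ HasUndirectedCycle (rel S)

-- Translation.  Fresh labels are drawn from a counter n; the result
-- also returns the updated counter.  Polarity: left = 𝔏₁, right = 𝔏₂.

data Pol : Set where
  left right : Pol

flip : Pol → Pol
flip left  = right
flip right = left

tr : Pol → Label → ℕ → Str → LSeq × ℕ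
tr p     w n I           = emptyL , n
tr left  w n (fm A)      = lseq [] ((w , A) ∷ []) [] , n
tr right w n (fm A)      = lseq [] [] ((w , A) ∷ []) , n
tr p     w n (ast X)     = tr (flip p) w n X
tr left  w n (bul X) with tr left n (suc n) X
... | S , n' = (lseq ((n , w) ∷ []) [] [] ⊗ S) , n'
tr right w n (bul X) with tr right n (suc n) X
... | S , n' = (lseq ((w , n) ∷ []) [] [] ⊗ S) , n'
tr p     w n (X ∘ Y) with tr p w n X
... | S₁ , n₁ with tr p w n₁ Y
...   | S₂ , n₂ = (S₁ ⊗ S₂) , n₂

-- 𝔏_w(X ⊢ Y); fresh labels start at suc w, hence differ from w and
-- from each other.
𝔏 : Label → DSeq → LSeq
𝔏 w (X ⊢ Y) with tr left w (suc w) X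
... | S₁ , n₁ with tr right w n₁ Y
...   | S₂ , _ = S₁ ⊗ S₂

-- Each • adds one edge between the current label and a fresh one, so by
-- induction the relational part is connected from the root. Every edge is
-- named by its fresh, hence larger, end, and fresh labels are never reused:
-- each label is the larger end of at most one edge, which rules out cycles.
-- Every node of the structure contributes at most one atom or formula, which
-- gives the length bound. Finally, the translation at w is the translation
-- at 0 with all labels shifted by w, and shifting is an isomorphism.

module Submission where

open import Defs
open import Data.Empty using (⊥; ⊥-elim)
open import Data.List using (List; []; _∷_; _++_; length; map)
open import Data.List.Membership.Propositional using (_∈_; _∉_)
open import Data.List.Membership.Propositional.Properties using (∈-++⁻; ∈-map⁺; ∈-map⁻)
open import Data.List.Properties using (length-++; length-deduplicate; map-++; map-∘)
open import Data.List.Relation.Binary.Subset.Propositional using (_⊆_)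
open import Data.List.Relation.Binary.Subset.Propositional.Properties using (xs⊆xs++ys; xs⊆ys++xs)
open import Data.List.Relation.Unary.All.Properties using (All¬⇒¬Any)
open import Data.List.Relation.Unary.AllPairs using (_∷_)
open import Data.List.Relation.Unary.Any using (here; there)
open import Data.List.Relation.Unary.Unique.Propositional using (Unique)
open import Data.Nat using (ℕ; suc; _+_; _∸_; _≤_; _<_; _⊔_; z≤n; s≤s)
open import Data.Nat.Properties
  using ( ≤-refl; ≤-trans; ≤-reflexive; <⇒≤; <⇒≢; <⇒≱; <-trans; <-≤-trans; <-cmp; n≤1+n
        ; ⊔-comm; m≤n⇒m⊔n≡n; m≥n⇒m⊔n≡m; +-comm; +-mono-≤; +-monoˡ-≤; m≤m+n
        ; +-cancelʳ-≡; m+n∸n≡m; +-commutativeSemigroup; _≟_; module ≤-Reasoning)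
open import Data.Product using (_×_; _,_; ∃-syntax; proj₁; proj₂; map₁)
import Data.Product as Product
open import Data.Product.Properties using (≡-dec)
open import Data.Sum using (_⊎_; inj₁; inj₂)
open import Function.Definitions using (Injective)
open import Relation.Binary.Definitions using (tri<; tri≈; tri>)
open import Relation.Binary.PropositionalEquality using (_≡_; _≢_; refl; sym; trans; cong; cong₂; subst)
open import Relation.Nullary using (¬_)
open import Algebra.Properties.CommutativeSemigroup +-commutativeSemigroup using (interchange)

maxEnd : RelAtom → Label
maxEnd (u , v) = u ⊔ v

Incident : Label → List RelAtom → Set
Incident x R = ∃[ u ] ((x , u) ∈ R ⊎ (u , x) ∈ R)

incident-⊆ : ∀ {x R R′} → R ⊆ R′ → Incident x R → Incident x R′
incident-⊆ R⊆R′ (u , inj₁ e∈R) = u , inj₁ (R⊆R′ e∈R)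
incident-⊆ R⊆R′ (u , inj₂ e∈R) = u , inj₂ (R⊆R′ e∈R)

incident-++⁻ : ∀ {x} R R′ → Incident x (R ++ R′) → Incident x R ⊎ Incident x R′
incident-++⁻ R R′ (u , inj₁ e∈) with ∈-++⁻ R e∈
... | inj₁ e∈R  = inj₁ (u , inj₁ e∈R)
... | inj₂ e∈R′ = inj₂ (u , inj₁ e∈R′)
incident-++⁻ R R′ (u , inj₂ e∈) with ∈-++⁻ R e∈
... | inj₁ e∈R  = inj₁ (u , inj₂ e∈R)
... | inj₂ e∈R′ = inj₂ (u , inj₂ e∈R′)

¬incident-[] : ∀ {x} → ¬ Incident x []
¬incident-[] (_ , inj₁ ())
¬incident-[] (_ , inj₂ ())

incident-labelsR : ∀ {x} R → x ∈ labelsR R → Incident x R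
incident-labelsR ((u , v) ∷ R) (here refl)         = v , inj₁ (here refl)
incident-labelsR ((u , v) ∷ R) (there (here refl)) = u , inj₂ (here refl)
incident-labelsR ((u , v) ∷ R) (there (there x∈)) = incident-⊆ there (incident-labelsR R x∈)

trail-⊆ : ∀ {R R′ v x es} → R ⊆ R′ → UTrail R v x es → UTrail R′ v x es
trail-⊆ R⊆R′ here       = here
trail-⊆ R⊆R′ (fwd e∈ t) = fwd (R⊆R′ e∈) (trail-⊆ R⊆R′ t)
trail-⊆ R⊆R′ (bwd e∈ t) = bwd (R⊆R′ e∈) (trail-⊆ R⊆R′ t)

trail-++ : ∀ {R a b c es fs} → UTrail R a b es → UTrail R b c fs → UTrail R a c (es ++ fs)
trail-++ here       t = t
trail-++ (fwd e∈ s) t = fwd e∈ (trail-++ s t)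
trail-++ (bwd e∈ s) t = bwd e∈ (trail-++ s t)

trail-reverse : ∀ {R a b es} → UTrail R a b es → ∃[ fs ] UTrail R b a fs
trail-reverse here = _ , here
trail-reverse (fwd e∈ t) = _ , trail-++ (proj₂ (trail-reverse t)) (bwd e∈ here)
trail-reverse (bwd e∈ t) = _ , trail-++ (proj₂ (trail-reverse t)) (fwd e∈ here)

directed⇒undirected : ∀ {R u x es} → DTrail R u x es → UTrail R u x es
directed⇒undirected here       = here
directed⇒undirected (fwd e∈ t) = fwd e∈ (directed⇒undirected t)

-- Orienting every edge towards its larger end gives each vertex at most one
-- incoming edge, so there is no cycle: at the largest vertex of a cycle both
-- cycle edges would end.
record Ranked (R : List RelAtom) : Set where
  field
    irreflexive      : ∀ {e} → e ∈ R → proj₁ e ≢ proj₂ e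
    maxEnd-injective : ∀ {e e′} → e ∈ R → e′ ∈ R → maxEnd e ≡ maxEnd e′ → e ≡ e′
open Ranked

data Walk (R : List RelAtom) : Label → Label → List RelAtom → Set where
  []   : ∀ {v} → Walk R v v []
  step : ∀ {u v x e es} → e ∈ R → maxEnd e ≡ u ⊔ v → u ≢ v → Walk R v x es → Walk R u x (e ∷ es)

trail⇒walk : ∀ {R u x es} → Ranked R → UTrail R u x es → Walk R u x es
trail⇒walk rk here                  = []
trail⇒walk rk (fwd e∈ t)            = step e∈ refl (irreflexive rk e∈) (trail⇒walk rk t)
trail⇒walk rk (bwd {u} {v} e∈ t)    =
  step e∈ (⊔-comm v u) (λ u≡v → irreflexive rk e∈ (sym u≡v)) (trail⇒walk rk t)

private
  ⊔-< : ∀ {u v} → u < v → u ⊔ v ≡ v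
  ⊔-< u<v = m≤n⇒m⊔n≡n (<⇒≤ u<v)

  ⊔-> : ∀ {u v} → v < u → u ⊔ v ≡ u
  ⊔-> v<u = m≥n⇒m⊔n≡m (<⇒≤ v<u)

  head∉tail : ∀ {e : RelAtom} {es} → Unique (e ∷ es) → e ∉ es
  head∉tail (e≢es ∷ _) = All¬⇒¬Any e≢es

walk-ascends : ∀ {R u x es e₀} → Ranked R → Walk R u x es → Unique es →
               e₀ ∈ R → maxEnd e₀ ≡ u → e₀ ∉ es → u ≤ x
walk-ascends rk [] _ _ _ _ = ≤-refl
walk-ascends rk (step {u} {v} e∈ top u≢v w) uq@(_ ∷ uq′) e₀∈ top₀ e₀∉ with <-cmp u v
... | tri< u<v _ _ =
  <⇒≤ (<-≤-trans u<v (walk-ascends rk w uq′ e∈ (trans top (⊔-< u<v)) (head∉tail uq)))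
... | tri≈ _ u≡v _ = ⊥-elim (u≢v u≡v)
... | tri> _ _ v<u =
  ⊥-elim (e₀∉ (here (maxEnd-injective rk e₀∈ e∈ (trans top₀ (sym (trans top (⊔-> v<u)))))))

walk-avoids : ∀ {R u x es p e₀} → Ranked R → Walk R u x es → Unique es →
              u < p → e₀ ∈ R → maxEnd e₀ ≡ p → e₀ ∉ es → x ≢ p
walk-avoids rk [] _ u<p _ _ _ = <⇒≢ u<p
walk-avoids rk (step {u} {v} e∈ top u≢v w) uq@(_ ∷ uq′) u<p e₀∈ top₀ e₀∉
  with <-cmp u v
... | tri≈ _ u≡v _ = ⊥-elim (u≢v u≡v)
... | tri> _ _ v<u = walk-avoids rk w uq′ (<-trans v<u u<p) e₀∈ top₀ (λ e₀∈es → e₀∉ (there e₀∈es))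
... | tri< u<v _ _ with <-cmp v _
...   | tri< v<p _ _ = walk-avoids rk w uq′ v<p e₀∈ top₀ (λ e₀∈es → e₀∉ (there e₀∈es))
...   | tri≈ _ v≡p _ =
  ⊥-elim (e₀∉ (here (maxEnd-injective rk e₀∈ e∈ (trans top₀ (sym (trans top (trans (⊔-< u<v) v≡p)))))))
...   | tri> _ _ p<v = λ x≡p →
  <⇒≱ p<v (subst (v ≤_) x≡p (walk-ascends rk w uq′ e∈ (trans top (⊔-< u<v)) (head∉tail uq)))

¬closed-walk : ∀ {R v es} → Ranked R → Walk R v v es → es ≢ [] → Unique es → ⊥
¬closed-walk rk [] es≢[] _ = es≢[] refl
¬closed-walk rk (step {u} {v} e∈ top u≢v w) _ uq@(_ ∷ uq′) with <-cmp u v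
... | tri< u<v _ _ = <⇒≱ u<v (walk-ascends rk w uq′ e∈ (trans top (⊔-< u<v)) (head∉tail uq))
... | tri≈ _ u≡v _ = u≢v u≡v
... | tri> _ _ v<u = walk-avoids rk w uq′ v<u e∈ (trans top (⊔-> v<u)) (head∉tail uq) refl

ranked⇒¬undirected-cycle : ∀ {R} → Ranked R → ¬ HasUndirectedCycle R
ranked⇒¬undirected-cycle rk (_ , _ , t , es≢[] , uq) = ¬closed-walk rk (trail⇒walk rk t) es≢[] uq

ranked⇒¬directed-cycle : ∀ {R} → Ranked R → ¬ HasDirectedCycle R
ranked⇒¬directed-cycle rk (_ , _ , t , es≢[] , uq) =
  ¬closed-walk rk (trail⇒walk rk (directed⇒undirected t)) es≢[] uq

Attached : Label → Label → List RelAtom → Set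
Attached x w R = x ≡ w ⊎ Incident x R

attached-++ˡ : ∀ {x w} R R′ → Attached x w R → Attached x w (R ++ R′)
attached-++ˡ R R′ (inj₁ x≡w) = inj₁ x≡w
attached-++ˡ R R′ (inj₂ ie)  = inj₂ (incident-⊆ (xs⊆xs++ys R R′) ie)

attached-[] : ∀ {x w} → Attached x w [] → x ≡ w
attached-[] (inj₁ x≡w) = x≡w
attached-[] (inj₂ ie)  = ⊥-elim (¬incident-[] ie)

-- The invariant of the translation from root w with fresh labels drawn from
-- [n, n′): every edge is named by its larger end, a label in [n, n′).
record Rooted (S : LSeq) (w n n′ : Label) : Set where
  field
    n≤n′          : n ≤ n′
    ranked        : Ranked (rel S)
    maxEnd-bounds : ∀ {e} → e ∈ rel S → n ≤ maxEnd e × maxEnd e < n′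
    reachable     : ∀ {x} → Incident x (rel S) → ∃[ es ] UTrail (rel S) w x es
    ant-attached  : ∀ {x A} → (x , A) ∈ ant S → Attached x w (rel S)
    suc-attached  : ∀ {x A} → (x , A) ∈ suc' S → Attached x w (rel S)
    root          : rel S ≡ [] ⊎ Incident w (rel S)
open Rooted

attached-reachable : ∀ {S w n n′ x} → Rooted S w n n′ → Attached x w (rel S) →
                     ∃[ es ] UTrail (rel S) w x es
attached-reachable r (inj₁ refl) = _ , here
attached-reachable r (inj₂ ie)   = reachable r ie

formulas-rooted : ∀ {Γ Δ w n} → (∀ {x A} → (x , A) ∈ Γ → x ≡ w) → (∀ {x A} → (x , A) ∈ Δ → x ≡ w) →
                  Rooted (lseq [] Γ Δ) w n n
formulas-rooted Γ-at-w Δ-at-w = record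
  { n≤n′          = ≤-refl
  ; ranked        = record { irreflexive = λ () ; maxEnd-injective = λ () }
  ; maxEnd-bounds = λ ()
  ; reachable     = λ ie → ⊥-elim (¬incident-[] ie)
  ; ant-attached  = λ x∈ → inj₁ (Γ-at-w x∈)
  ; suc-attached  = λ x∈ → inj₁ (Δ-at-w x∈)
  ; root          = inj₁ refl
  }

data Link (w n : Label) : RelAtom → Set where
  outward : Link w n (w , n)
  inward  : Link w n (n , w)

link-incident : ∀ {w n e} → Link w n e → Incident n (e ∷ [])
link-incident outward = _ , inj₂ (here refl)
link-incident inward  = _ , inj₁ (here refl)

edge-rooted : ∀ {w n e} → w < n → Link w n e → Rooted (lseq (e ∷ []) [] []) w n (suc n)
edge-rooted {w} {n} {e} w<n link = record
  { n≤n′          = n≤1+n n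
  ; ranked        = record { irreflexive = λ { (here refl) → irreflexive′ link }
                           ; maxEnd-injective = λ { (here refl) (here refl) _ → refl } }
  ; maxEnd-bounds = λ { (here refl) → subst (λ m → n ≤ m × m < suc n) (sym (maxEnd≡n link)) (≤-refl , ≤-refl) }
  ; reachable     = reach link
  ; ant-attached  = λ ()
  ; suc-attached  = λ ()
  ; root          = inj₂ (root′ link)
  }
  where
  irreflexive′ : Link w n e → proj₁ e ≢ proj₂ e
  irreflexive′ outward = <⇒≢ w<n
  irreflexive′ inward  = λ n≡w → <⇒≢ w<n (sym n≡w)

  maxEnd≡n : Link w n e → maxEnd e ≡ n
  maxEnd≡n outward = m≤n⇒m⊔n≡n (<⇒≤ w<n)
  maxEnd≡n inward  = m≥n⇒m⊔n≡m (<⇒≤ w<n)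

  reach : Link w n e → ∀ {x} → Incident x (e ∷ []) → ∃[ es ] UTrail (e ∷ []) w x es
  reach outward (_ , inj₁ (here refl)) = _ , here
  reach outward (_ , inj₂ (here refl)) = _ , fwd (here refl) here
  reach inward  (_ , inj₁ (here refl)) = _ , bwd (here refl) here
  reach inward  (_ , inj₂ (here refl)) = _ , here

  root′ : Link w n e → Incident w (e ∷ [])
  root′ outward = _ , inj₁ (here refl)
  root′ inward  = _ , inj₂ (here refl)

⊗-rooted : ∀ {S₁ S₂ w v n n₁ n₂} → Rooted S₁ w n n₁ → Attached v w (rel S₁) → Rooted S₂ v n₁ n₂ →
           Rooted (S₁ ⊗ S₂) w n n₂
⊗-rooted {S₁} {S₂} {w} {v} {n} {n₁} {n₂} r₁ v-att r₂ = record
  { n≤n′          = ≤-trans (n≤n′ r₁) (n≤n′ r₂)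
  ; ranked        = record { irreflexive = irreflexive′ ; maxEnd-injective = injective }
  ; maxEnd-bounds = bounds
  ; reachable     = reach
  ; ant-attached  = formulas (ant-attached r₁) (ant-attached r₂)
  ; suc-attached  = formulas (suc-attached r₁) (suc-attached r₂)
  ; root          = root′ (root r₁) (root r₂)
  }
  where
  R₁ = rel S₁
  R₂ = rel S₂

  irreflexive′ : ∀ {e} → e ∈ R₁ ++ R₂ → proj₁ e ≢ proj₂ e
  irreflexive′ e∈ with ∈-++⁻ R₁ e∈
  ... | inj₁ e∈₁ = irreflexive (ranked r₁) e∈₁
  ... | inj₂ e∈₂ = irreflexive (ranked r₂) e∈₂

  separated : ∀ {e e′} → e ∈ R₁ → e′ ∈ R₂ → maxEnd e ≢ maxEnd e′
  separated e∈₁ e′∈₂ = <⇒≢ (<-≤-trans (proj₂ (maxEnd-bounds r₁ e∈₁)) (proj₁ (maxEnd-bounds r₂ e′∈₂)))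

  injective : ∀ {e e′} → e ∈ R₁ ++ R₂ → e′ ∈ R₁ ++ R₂ → maxEnd e ≡ maxEnd e′ → e ≡ e′
  injective e∈ e′∈ same with ∈-++⁻ R₁ e∈ | ∈-++⁻ R₁ e′∈
  ... | inj₁ e∈₁ | inj₁ e′∈₁ = maxEnd-injective (ranked r₁) e∈₁ e′∈₁ same
  ... | inj₂ e∈₂ | inj₂ e′∈₂ = maxEnd-injective (ranked r₂) e∈₂ e′∈₂ same
  ... | inj₁ e∈₁ | inj₂ e′∈₂ = ⊥-elim (separated e∈₁ e′∈₂ same)
  ... | inj₂ e∈₂ | inj₁ e′∈₁ = ⊥-elim (separated e′∈₁ e∈₂ (sym same))

  bounds : ∀ {e} → e ∈ R₁ ++ R₂ → n ≤ maxEnd e × maxEnd e < n₂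
  bounds e∈ with ∈-++⁻ R₁ e∈
  ... | inj₁ e∈₁ = proj₁ (maxEnd-bounds r₁ e∈₁) , <-≤-trans (proj₂ (maxEnd-bounds r₁ e∈₁)) (n≤n′ r₂)
  ... | inj₂ e∈₂ = ≤-trans (n≤n′ r₁) (proj₁ (maxEnd-bounds r₂ e∈₂)) , proj₂ (maxEnd-bounds r₂ e∈₂)

  reach : ∀ {x} → Incident x (R₁ ++ R₂) → ∃[ es ] UTrail (R₁ ++ R₂) w x es
  reach ie with incident-++⁻ R₁ R₂ ie
  ... | inj₁ ie₁ = _ , trail-⊆ (xs⊆xs++ys R₁ R₂) (proj₂ (reachable r₁ ie₁))
  ... | inj₂ ie₂ = _ , trail-++ (trail-⊆ (xs⊆xs++ys R₁ R₂) (proj₂ (attached-reachable r₁ v-att)))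
                               (trail-⊆ (xs⊆ys++xs R₂ R₁) (proj₂ (reachable r₂ ie₂)))

  lift : ∀ {x} → Attached x v R₂ → Attached x w (R₁ ++ R₂)
  lift (inj₁ refl) = attached-++ˡ R₁ R₂ v-att
  lift (inj₂ ie)   = inj₂ (incident-⊆ (xs⊆ys++xs R₂ R₁) ie)

  formulas : ∀ {Γ₁ Γ₂ : List LFm} → (∀ {x A} → (x , A) ∈ Γ₁ → Attached x w R₁) →
             (∀ {x A} → (x , A) ∈ Γ₂ → Attached x v R₂) → ∀ {x A} → (x , A) ∈ Γ₁ ++ Γ₂ → Attached x w (R₁ ++ R₂)
  formulas {Γ₁} att₁ att₂ x∈ with ∈-++⁻ Γ₁ x∈
  ... | inj₁ x∈₁ = attached-++ˡ R₁ R₂ (att₁ x∈₁)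
  ... | inj₂ x∈₂ = lift (att₂ x∈₂)

  root′ : R₁ ≡ [] ⊎ Incident w R₁ → R₂ ≡ [] ⊎ Incident v R₂ → R₁ ++ R₂ ≡ [] ⊎ Incident w (R₁ ++ R₂)
  root′ (inj₂ ie₁)   _             = inj₂ (incident-⊆ (xs⊆xs++ys R₁ R₂) ie₁)
  root′ (inj₁ R₁≡[]) (inj₁ R₂≡[]) rewrite R₁≡[] | R₂≡[] = inj₁ refl
  root′ (inj₁ R₁≡[]) (inj₂ ie₂) =
    inj₂ (incident-⊆ (xs⊆ys++xs R₂ R₁) (subst (λ y → Incident y R₂) v≡w ie₂))
    where v≡w = attached-[] (subst (Attached v w) R₁≡[] v-att)

private
  at-root : ∀ {w x : Label} {A B : Fm} → (x , B) ∈ (w , A) ∷ [] → x ≡ w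
  at-root (here refl) = refl

tr-rooted : ∀ p w n X → w < n → Rooted (proj₁ (tr p w n X)) w n (proj₂ (tr p w n X))
tr-rooted p     w n I       _   = formulas-rooted (λ ()) (λ ())
tr-rooted left  w n (fm A)  _   = formulas-rooted at-root (λ ())
tr-rooted right w n (fm A)  _   = formulas-rooted (λ ()) at-root
tr-rooted p     w n (ast X) w<n = tr-rooted (flip p) w n X w<n
tr-rooted left  w n (bul X) w<n =
  ⊗-rooted (edge-rooted w<n inward) (inj₂ (link-incident inward)) (tr-rooted left n (suc n) X ≤-refl)
tr-rooted right w n (bul X) w<n =
  ⊗-rooted (edge-rooted w<n outward) (inj₂ (link-incident outward)) (tr-rooted right n (suc n) X ≤-refl)
tr-rooted p     w n (X ∘ Y) w<n =
  ⊗-rooted rX (inj₁ refl) (tr-rooted p w _ Y (<-≤-trans w<n (n≤n′ rX)))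
  where rX = tr-rooted p w n X w<n

formula-attached : ∀ {S w n n′ x A} → Rooted S w n n′ → (x , A) ∈ ant S ++ suc' S → Attached x w (rel S)
formula-attached {S} r xA∈ with ∈-++⁻ (ant S) xA∈
... | inj₁ xA∈Γ = ant-attached r xA∈Γ
... | inj₂ xA∈Δ = suc-attached r xA∈Δ

label-attached : ∀ {S w n n′ x} → Rooted S w n n′ → x ∈ labels S → Attached x w (rel S)
label-attached {lseq R Γ Δ} r x∈ with ∈-++⁻ (labelsR R) x∈
... | inj₁ x∈R  = inj₂ (incident-labelsR R x∈R)
... | inj₂ x∈ΓΔ with ∈-map⁻ proj₁ (subst (_ ∈_) (sym (map-++ proj₁ Γ Δ)) x∈ΓΔ)
...   | _ , xA∈ , refl = formula-attached r xA∈

rooted⇒polytree : ∀ {S w n n′} → Rooted S w n n′ → IsPolytree S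
rooted⇒polytree {S} {w} r =
  single-label , labels-incident , connected ,
  ranked⇒¬directed-cycle (ranked r) , ranked⇒¬undirected-cycle (ranked r)
  where
  single-label : rel S ≡ [] → ∃[ v ] (∀ {x A} → (x , A) ∈ ant S ++ suc' S → x ≡ v)
  single-label R≡[] = w , λ xA∈ → attached-[] (subst (Attached _ w) R≡[] (formula-attached r xA∈))

  labels-incident : rel S ≢ [] → ∀ {x A} → (x , A) ∈ ant S ++ suc' S → Incident x (rel S)
  labels-incident R≢[] xA∈ with formula-attached r xA∈ | root r
  ... | inj₂ ie   | _          = ie
  ... | inj₁ refl | inj₂ ie    = ie
  ... | inj₁ refl | inj₁ R≡[] = ⊥-elim (R≢[] R≡[])

  connected : Connected S
  connected v∈ x∈ =
    _ , trail-++ (proj₂ (trail-reverse (proj₂ (attached-reachable r (label-attached r v∈)))))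
                 (proj₂ (attached-reachable r (label-attached r x∈)))

𝔏-polytree : ∀ w D → IsPolytree (𝔏 w D)
𝔏-polytree w (X ⊢ Y) = rooted⇒polytree (⊗-rooted rX (inj₁ refl) (tr-rooted right w _ Y (n≤n′ rX)))
  where rX = tr-rooted left w (suc w) X ≤-refl

-- Counts relational atoms with multiplicity, unlike lLen.
size : LSeq → ℕ
size S = length (rel S) + length (ant S) + length (suc' S)

lLen≤size : ∀ S → lLen S ≤ size S
lLen≤size (lseq R Γ Δ) =
  +-monoˡ-≤ (length Δ) (+-monoˡ-≤ (length Γ) (length-deduplicate (≡-dec _≟_ _≟_) R))

+-regroup₃ : ∀ a₁ a₂ b₁ b₂ c₁ c₂ → (a₁ + a₂) + (b₁ + b₂) + (c₁ + c₂) ≡ (a₁ + b₁ + c₁) + (a₂ + b₂ + c₂)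
+-regroup₃ a₁ a₂ b₁ b₂ c₁ c₂ =
  trans (cong (_+ (c₁ + c₂)) (interchange a₁ a₂ b₁ b₂)) (interchange (a₁ + b₁) (a₂ + b₂) c₁ c₂)

size-⊗ : ∀ S₁ S₂ → size (S₁ ⊗ S₂) ≡ size S₁ + size S₂
size-⊗ (lseq R₁ Γ₁ Δ₁) (lseq R₂ Γ₂ Δ₂)
  rewrite length-++ R₁ {R₂} | length-++ Γ₁ {Γ₂} | length-++ Δ₁ {Δ₂} =
  +-regroup₃ (length R₁) (length R₂) (length Γ₁) (length Γ₂) (length Δ₁) (length Δ₂)

tr-size : ∀ p w n X → size (proj₁ (tr p w n X)) ≤ strLen X
tr-size p     w n I       = z≤n
tr-size left  w n (fm A)  = s≤s z≤n
tr-size right w n (fm A)  = s≤s z≤n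
tr-size p     w n (ast X) = ≤-trans (tr-size (flip p) w n X) (m≤m+n (strLen X) 1)
tr-size left  w n (bul X) = ≤-trans (s≤s (tr-size left n (suc n) X)) (≤-reflexive (+-comm 1 (strLen X)))
tr-size right w n (bul X) = ≤-trans (s≤s (tr-size right n (suc n) X)) (≤-reflexive (+-comm 1 (strLen X)))
tr-size p     w n (X ∘ Y) = begin
  size (SX ⊗ SY)         ≡⟨ size-⊗ SX SY ⟩
  size SX + size SY      ≤⟨ +-mono-≤ (tr-size p w n X) (tr-size p w _ Y) ⟩
  strLen X + strLen Y    ≤⟨ m≤m+n _ 1 ⟩
  strLen X + strLen Y + 1 ∎
  where
  open ≤-Reasoning
  SX = proj₁ (tr p w n X)
  SY = proj₁ (tr p w (proj₂ (tr p w n X)) Y)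

𝔏-size : ∀ w D → lLen (𝔏 w D) ≤ dLen D
𝔏-size w (X ⊢ Y) = begin
  lLen (SX ⊗ SY)      ≤⟨ lLen≤size (SX ⊗ SY) ⟩
  size (SX ⊗ SY)      ≡⟨ size-⊗ SX SY ⟩
  size SX + size SY   ≤⟨ +-mono-≤ (tr-size left w (suc w) X) (tr-size right w _ Y) ⟩
  strLen X + strLen Y ∎
  where
  open ≤-Reasoning
  SX = proj₁ (tr left w (suc w) X)
  SY = proj₁ (tr right w (proj₂ (tr left w (suc w) X)) Y)

∈-map-injective : ∀ {A B : Set} {f : A → B} → Injective _≡_ _≡_ f → ∀ {x xs} → f x ∈ map f xs → x ∈ xs
∈-map-injective f-inj fx∈ with ∈-map⁻ _ fx∈
... | _ , y∈ , fx≡fy = subst (_∈ _) (sym (f-inj fx≡fy)) y∈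

relabelAtom : (Label → Label) → RelAtom → RelAtom
relabelAtom g = Product.map g g

relabel : (Label → Label) → LSeq → LSeq
relabel g (lseq R Γ Δ) = lseq (map (relabelAtom g) R) (map (map₁ g) Γ) (map (map₁ g) Δ)

relabel-⊗ : ∀ g S₁ S₂ → relabel g (S₁ ⊗ S₂) ≡ relabel g S₁ ⊗ relabel g S₂
relabel-⊗ g (lseq R₁ Γ₁ Δ₁) (lseq R₂ Γ₂ Δ₂)
  rewrite map-++ (relabelAtom g) R₁ R₂ | map-++ (map₁ g) Γ₁ Γ₂ | map-++ (map₁ g) Δ₁ Δ₂ = refl

labelsR-relabel : ∀ g R → labelsR (map (relabelAtom g) R) ≡ map g (labelsR R)
labelsR-relabel g []            = refl
labelsR-relabel g ((u , v) ∷ R) = cong (λ ls → g u ∷ g v ∷ ls) (labelsR-relabel g R)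

formula-labels-relabel : ∀ (g : Label → Label) (Γ : List LFm) → map proj₁ (map (map₁ g) Γ) ≡ map g (map proj₁ Γ)
formula-labels-relabel g Γ = trans (sym (map-∘ Γ)) (map-∘ Γ)

labels-relabel : ∀ g S → labels (relabel g S) ≡ map g (labels S)
labels-relabel g (lseq R Γ Δ)
  rewrite map-++ g (labelsR R) (map proj₁ Γ ++ map proj₁ Δ) | map-++ g (map proj₁ Γ) (map proj₁ Δ) =
  cong₂ _++_ (labelsR-relabel g R)
    (cong₂ _++_ (formula-labels-relabel g Γ) (formula-labels-relabel g Δ))

tr-+ : ∀ p w n k X → tr p (w + k) (n + k) X ≡ Product.map (relabel (_+ k)) (_+ k) (tr p w n X)
tr-+ p     w n k I       = refl
tr-+ left  w n k (fm A)  = refl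
tr-+ right w n k (fm A)  = refl
tr-+ p     w n k (ast X) = tr-+ (flip p) w n k X
tr-+ left  w n k (bul X) rewrite tr-+ left n (suc n) k X = refl
tr-+ right w n k (bul X) rewrite tr-+ right n (suc n) k X = refl
tr-+ p     w n k (X ∘ Y) rewrite tr-+ p w n k X | tr-+ p w (proj₂ (tr p w n X)) k Y =
  cong₂ _,_ (sym (relabel-⊗ (_+ k) (proj₁ (tr p w n X)) _)) refl

-- Fresh labels start at suc w, so the whole translation is the one at 0 shifted by w.
𝔏-+ : ∀ w D → 𝔏 w D ≡ relabel (_+ w) (𝔏 0 D)
𝔏-+ w (X ⊢ Y) rewrite tr-+ left 0 1 w X | tr-+ right 0 (proj₂ (tr left 0 1 X)) w Y =
  sym (relabel-⊗ (_+ w) (proj₁ (tr left 0 1 X)) _)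

∈-map-transfer : ∀ {A B C : Set} {φ : A → B} {ψ : A → C} {x xs} → Injective _≡_ _≡_ φ → Injective _≡_ _≡_ ψ →
                 (φ x ∈ map φ xs → ψ x ∈ map ψ xs) × (ψ x ∈ map ψ xs → φ x ∈ map φ xs)
∈-map-transfer {φ = φ} {ψ} φ-inj ψ-inj =
  (λ φx∈ → ∈-map⁺ ψ (∈-map-injective φ-inj φx∈)) , (λ ψx∈ → ∈-map⁺ φ (∈-map-injective ψ-inj ψx∈))

relabelAtom-injective : ∀ {g} → Injective _≡_ _≡_ g → Injective _≡_ _≡_ (relabelAtom g)
relabelAtom-injective g-inj eq = cong₂ _,_ (g-inj (cong proj₁ eq)) (g-inj (cong proj₂ eq))

map₁-injective : ∀ {g : Label → Label} → Injective _≡_ _≡_ g → Injective _≡_ _≡_ (map₁ {C = Fm} g)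
map₁-injective g-inj eq = cong₂ _,_ (g-inj (cong proj₁ eq)) (cong proj₂ eq)

relabel-≅ : ∀ {g h} (f : Label → Label) → (∀ x → f (g x) ≡ h x) →
            Injective _≡_ _≡_ g → Injective _≡_ _≡_ h → ∀ S → relabel g S ≅ relabel h S
relabel-≅ {g} {h} f f∘g≡h g-inj h-inj S@(lseq R Γ Δ) = record
  { f      = f
  ; into   = λ x∈ → into (preimage g x∈)
  ; inj    = λ x∈ x′∈ → inj (preimage g x∈) (preimage g x′∈)
  ; onto   = λ v∈ → onto (preimage h v∈)
  ; relIso = λ x∈ x′∈ → relIso (preimage g x∈) (preimage g x′∈)
  ; antIso = λ A x∈ → formulaIso Γ A (preimage g x∈)
  ; sucIso = λ A x∈ → formulaIso Δ A (preimage g x∈)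
  }
  where
  Preimage : (Label → Label) → Label → Set
  Preimage k x = ∃[ y ] (y ∈ labels S × x ≡ k y)

  preimage : ∀ k {x} → x ∈ labels (relabel k S) → Preimage k x
  preimage k x∈ = ∈-map⁻ k (subst (_ ∈_) (labels-relabel k S) x∈)

  image : ∀ k {y} → y ∈ labels S → k y ∈ labels (relabel k S)
  image k y∈ = subst (_ ∈_) (sym (labels-relabel k S)) (∈-map⁺ k y∈)

  into : ∀ {x} → Preimage g x → f x ∈ labels (relabel h S)
  into (y , y∈ , refl) = subst (_∈ labels (relabel h S)) (sym (f∘g≡h y)) (image h y∈)

  inj : ∀ {x x′} → Preimage g x → Preimage g x′ → f x ≡ f x′ → x ≡ x′
  inj (y , _ , refl) (y′ , _ , refl) eq = cong g (h-inj (trans (sym (f∘g≡h y)) (trans eq (f∘g≡h y′))))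

  onto : ∀ {v} → Preimage h v → ∃[ x ] (x ∈ labels (relabel g S) × f x ≡ v)
  onto (y , y∈ , refl) = g y , image g y∈ , f∘g≡h y

  relIso : ∀ {x x′} → Preimage g x → Preimage g x′ →
           ((x , x′) ∈ map (relabelAtom g) R → (f x , f x′) ∈ map (relabelAtom h) R) ×
           ((f x , f x′) ∈ map (relabelAtom h) R → (x , x′) ∈ map (relabelAtom g) R)
  relIso (y , _ , refl) (y′ , _ , refl) rewrite f∘g≡h y | f∘g≡h y′ =
    ∈-map-transfer (relabelAtom-injective g-inj) (relabelAtom-injective h-inj)

  formulaIso : ∀ (Θ : List LFm) A {x} → Preimage g x →
               ((x , A) ∈ map (map₁ g) Θ → (f x , A) ∈ map (map₁ h) Θ) ×
               ((f x , A) ∈ map (map₁ h) Θ → (x , A) ∈ map (map₁ g) Θ)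
  formulaIso Θ A (y , _ , refl) rewrite f∘g≡h y = ∈-map-transfer (map₁-injective g-inj) (map₁-injective h-inj)

𝔏-≅ : ∀ D w u → 𝔏 w D ≅ 𝔏 u D
𝔏-≅ D w u rewrite 𝔏-+ w D | 𝔏-+ u D =
  relabel-≅ (λ x → x ∸ w + u) (λ x → cong (_+ u) (m+n∸n≡m x w))
    (λ {x} {y} → +-cancelʳ-≡ w x y) (λ {x} {y} → +-cancelʳ-≡ u x y) (𝔏 0 D)

lemma3 : (D : DSeq) →
    (∀ w → IsPolytree (𝔏 w D))
    × (∀ w → lLen (𝔏 w D) ≤ dLen D)
    × (∀ w u → 𝔏 w D ≅ 𝔏 u D)
lemma3 D = (λ w → 𝔏-polytree w D) , (λ w → 𝔏-size w D) , 𝔏-≅ D
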